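{- Let $1\le m\le n$ and $\pi\in\mathcal{S}_n$. Let $(C_1,\dots,C_{m-1})$ be a partial parking function with outcome $\pi^{(m-1)}$, let $p=\pi_m^{ -1}$, and let $C_m\subseteq[n]$ be of the form $[r,n]=\{r,\dots,n\}$ with $1\le r\le n$. Then $(C_1,\dots,C_m)$ is a partial parking function with outcome $\pi^{(m)}$ if and only if $p-a_p(\pi)+1\le r\le p$.
   Context: Let $[n]=\{1,\dots,n\}$, $\mathcal{S}_n$ the permutations of $[n]$ in one-line notation, and $\pi_i^{ -1}$ the position $j$ with $\pi_j=i$. For $0\le m\le n$, $S_{m,n}$ is the set of strings $\sigma_1\cdots\sigma_n$ over $\{1,\dots,m,*\}$ in which each of $1,\dots,m$ occurs exactly once and other letters are $*$; $\sigma_i^{ -1}$ is the index $j$ with $\sigma_j=i$. For $\pi\in\mathcal{S}_n$, $\pi^{(m)}\in S_{m,n}$ is obtained from $\pi$ by replacing every letter greater than $m$ by $*$. A tuple $(C_1,\dots,C_m)$ is a partial parking function with outcome $\sigma\in S_{m,n}$ if every $C_i$ has the form $[c_i,n]=\{c_i,\dots,n\}$ with $1\le c_i\le n$, and for all $1\le i\le m$, $\sigma_i^{ -1}$ is the smallest element of $C_i\setminus\{\sigma_{i'}^{ -1}:i'<i\}$. For $1\le i\le n$, $a_i(\pi)$ is the largest $j$ with $1\le j\le i$ such that $\pi_i\ge\pi_{i'}$ for all $i-j+1\le i'\le i$. -}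

module Defs where

open import Data.Nat using (ℕ; zero; suc; _≤_; _<_; _≤?_; _≡ᵇ_)
open import Data.Bool using (if_then_else_)
open import Data.Maybe using (Maybe; just; nothing)
open import Data.Product using (_×_; ∃-syntax)
open import Relation.Nullary using (¬_)
open import Relation.Nullary.Decidable using (⌊_⌋)
open import Relation.Binary.PropositionalEquality using (_≡_)

-- Everything is 1-based, as in the paper: positions and letters are
-- natural numbers in [1,n]; values outside [1,n] are irrelevant.

IsPerm : ℕ → (ℕ → ℕ) → Set
IsPerm n π =
  (∀ i → 1 ≤ i → i ≤ n → 1 ≤ π i × π i ≤ n)
  × (∀ i j → 1 ≤ i → i ≤ n → 1 ≤ j → j ≤ n → π i ≡ π j → i ≡ j)
  × (∀ v → 1 ≤ v → v ≤ n → ∃[ i ] (1 ≤ i × i ≤ n × π i ≡ v))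

-- Strings over {1,…,m,*}: position j ↦ just k (letter k) or nothing (*).
Str : Set
Str = ℕ → Maybe ℕ

restrict : (ℕ → ℕ) → ℕ → Str
restrict π m j = if ⌊ π j ≤? m ⌋ then just (π j) else nothing

-- A tuple (C_1,…,C_m) with C_i = [c i , n] is encoded by c : ℕ → ℕ
-- (only c 1, …, c m matter).  j ∈ C_i  iff  c i ≤ j ≤ n.
InC : ℕ → (ℕ → ℕ) → ℕ → ℕ → Set
InC n c i j = c i ≤ j × j ≤ n

Taken : Str → ℕ → ℕ → Set
Taken σ i j = ∃[ i' ] (1 ≤ i' × i' < i × σ j ≡ just i')

IsPPF : ℕ → ℕ → (ℕ → ℕ) → Str → Set
IsPPF n m c σ =
  (∀ i → 1 ≤ i → i ≤ m → 1 ≤ c i × c i ≤ n)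
  × (∀ i → 1 ≤ i → i ≤ m →
       ∃[ j ] (1 ≤ j × j ≤ n × σ j ≡ just i
              × InC n c i j × ¬ Taken σ i j
              × (∀ j' → InC n c i j' → ¬ Taken σ i j' → j ≤ j')))

extend : (ℕ → ℕ) → ℕ → ℕ → (ℕ → ℕ)
extend c m r i = if i ≡ᵇ m then r else c i

-- a_i(π): the largest j ∈ [1,i] with π_i ≥ π_{i'} for all i-j+1 ≤ i' ≤ i.
-- goLeft π v k counts how many consecutive positions k, k-1, …, 1
-- (scanning leftwards from k) carry letters ≤ v.
goLeft : (ℕ → ℕ) → ℕ → ℕ → ℕ
goLeft π v zero = zero
goLeft π v (suc k) = if ⌊ π (suc k) ≤? v ⌋ then suc (goLeft π v k) else zero

a : (ℕ → ℕ) → ℕ → ℕ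
a π zero = zero
a π (suc k) = suc (goLeft π (π (suc k)) k)

module Submission where

-- A partial parking function is checked car by car, and whether
-- car i parks at position j only depends on its preference c i and on the
-- positions of the letters below i.  Hence the first m-1 cars of the extended
-- tuple (C_1,…,C_m) still park as in π^(m-1) (extend-ppf), and the extended
-- tuple has outcome π^(m) iff car m, with preference r, parks at p = π⁻¹(m)
-- (ppf-last / ppf-snoc).  In π^(m) the positions taken before car m are those
-- carrying letters smaller than m, so car m parks at p iff r ≤ p and every
-- position in [r, p-1] carries a letter smaller than m, equivalently at most
-- m = π_p (last-car-parks⇔, occupied-before⇔).  Finally the leftward scan goLeft
-- defining a_p(π) says exactly that this holds iff p - a_p(π) + 1 ≤ r
-- (goLeft-window).

open import Defs
open import Data.Nat using (ℕ; _≤_; _+_; _∸_)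
open import Data.Product using (_×_)
open import Relation.Binary.PropositionalEquality using (_≡_)
open import Function.Bundles using (_⇔_)

open import Data.Nat using (zero; suc; _<_; _≤?_; _<?_; _≟_; _≡ᵇ_; z≤n; s≤s)
open import Data.Nat.Properties
open import Data.Bool using (true; false; T)
open import Data.Unit using (tt)
open import Data.Maybe using (just)
open import Data.Maybe.Properties using (just-injective)
open import Data.Product using (_,_; proj₁; ∃-syntax)
open import Data.Empty using (⊥-elim)
open import Data.Sum using (inj₁; inj₂)
open import Relation.Nullary using (¬_; yes; no)
open import Relation.Binary.PropositionalEquality using (refl; sym; trans; subst)
open import Function.Bundles using (mk⇔; Equivalence)
open import Function.Properties.Equivalence using () renaming (trans to ⇔-trans)

restrict-just : ∀ π m j x → restrict π m j ≡ just x → π j ≡ x × x ≤ m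
restrict-just π m j x e with π j ≤? m
... | yes le = just-injective e , subst (_≤ m) (just-injective e) le
... | no _ with e
... | ()

just-restrict : ∀ π m j x → π j ≡ x → x ≤ m → restrict π m j ≡ just x
just-restrict π m j x refl le with π j ≤? m
... | yes _ = refl
... | no nle = ⊥-elim (nle le)

restrict-transfer : ∀ π k m j x → x ≤ m → restrict π k j ≡ just x → restrict π m j ≡ just x
restrict-transfer π k m j x x≤m e = just-restrict π m j x (proj₁ (restrict-just π k j x e)) x≤m

taken-transfer : ∀ π k m i j → i ≤ m → Taken (restrict π k) i j → Taken (restrict π m) i j
taken-transfer π k m i j i≤m (i' , 1≤i' , i'<i , e) =
  i' , 1≤i' , i'<i , restrict-transfer π k m j i' (≤-trans (<⇒≤ i'<i) i≤m) e

taken-last⇔ : ∀ π m j → 1 ≤ π j → Taken (restrict π m) m j ⇔ π j < m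
taken-last⇔ π m j 1≤πj = mk⇔ to from
  where
  to : Taken (restrict π m) m j → π j < m
  to (i' , _ , i'<m , e) = subst (_< m) (sym (proj₁ (restrict-just π m j i' e))) i'<m
  from : π j < m → Taken (restrict π m) m j
  from πj<m = π j , 1≤πj , πj<m , just-restrict π m j (π j) refl (<⇒≤ πj<m)

extend-eq : ∀ c m r → extend c m r m ≡ r
extend-eq c m r with m ≡ᵇ m in e
... | true = refl
... | false = ⊥-elim (subst T e (≡⇒≡ᵇ m m refl))

extend-ne : ∀ c m r i → ¬ i ≡ m → extend c m r i ≡ c i
extend-ne c m r i i≢m with i ≡ᵇ m in e
... | true = ⊥-elim (i≢m (≡ᵇ⇒≡ i m (subst T (sym e) tt)))
... | false = refl

Parks : ℕ → (ℕ → ℕ) → Str → ℕ → Set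
Parks n c σ i =
  ∃[ j ] (1 ≤ j × j ≤ n × σ j ≡ just i
         × InC n c i j × ¬ Taken σ i j
         × (∀ j' → InC n c i j' → ¬ Taken σ i j' → j ≤ j'))

parks-transfer : ∀ n π k m c c' i → i ≤ k → i ≤ m → c' i ≡ c i →
                 Parks n c (restrict π k) i → Parks n c' (restrict π m) i
parks-transfer n π k m c c' i i≤k i≤m c'i≡ci (j , 1≤j , j≤n , ej , (cj , j≤n') , free , least) =
  j , 1≤j , j≤n , restrict-transfer π k m j i i≤m ej
  , (subst (_≤ j) (sym c'i≡ci) cj , j≤n')
  , (λ taken → free (taken-transfer π m k i j i≤k taken))
  , λ j' (c'j' , j'≤n) free' →
      least j' (subst (_≤ j') c'i≡ci c'j' , j'≤n) (λ taken → free' (taken-transfer π k m i j' i≤m taken))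

ppf-last : ∀ n m c σ → 1 ≤ m → IsPPF n m c σ → Parks n c σ m
ppf-last n m c σ 1≤m (_ , parks) = parks m 1≤m ≤-refl

ppf-snoc : ∀ n m c σ → IsPPF n (m ∸ 1) c σ → 1 ≤ c m × c m ≤ n → Parks n c σ m → IsPPF n m c σ
ppf-snoc n m c σ (ranges , parks) range-m parks-m = ranges' , parks'
  where
  below : ∀ i → i ≤ m → ¬ i ≡ m → i ≤ m ∸ 1
  below i i≤m i≢m = ∸-monoˡ-≤ 1 (≤∧≢⇒< i≤m i≢m)
  ranges' : ∀ i → 1 ≤ i → i ≤ m → 1 ≤ c i × c i ≤ n
  ranges' i 1≤i i≤m with i ≟ m
  ... | yes refl = range-m
  ... | no i≢m = ranges i 1≤i (below i i≤m i≢m)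
  parks' : ∀ i → 1 ≤ i → i ≤ m → Parks n c σ i
  parks' i 1≤i i≤m with i ≟ m
  ... | yes refl = parks-m
  ... | no i≢m = parks i 1≤i (below i i≤m i≢m)

extend-ppf : ∀ n m π c r → 1 ≤ m → IsPPF n (m ∸ 1) c (restrict π (m ∸ 1)) →
             IsPPF n (m ∸ 1) (extend c m r) (restrict π m)
extend-ppf n m π c r 1≤m (ranges , parks) = ranges' , parks'
  where
  ≢m : ∀ i → i ≤ m ∸ 1 → ¬ i ≡ m
  ≢m i i≤m-1 refl = <⇒≱ (∸-monoʳ-< {o = 0} (s≤s z≤n) 1≤m) i≤m-1
  ranges' : ∀ i → 1 ≤ i → i ≤ m ∸ 1 → 1 ≤ extend c m r i × extend c m r i ≤ n
  ranges' i 1≤i i≤m-1 rewrite extend-ne c m r i (≢m i i≤m-1) = ranges i 1≤i i≤m-1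
  parks' : ∀ i → 1 ≤ i → i ≤ m ∸ 1 → Parks n (extend c m r) (restrict π m) i
  parks' i 1≤i i≤m-1 =
    parks-transfer n π (m ∸ 1) m c (extend c m r) i i≤m-1 (≤-trans i≤m-1 (m∸n≤m m 1))
                   (extend-ne c m r i (≢m i i≤m-1)) (parks i 1≤i i≤m-1)

last-car-parks⇔ : ∀ n m π c p r → IsPerm n π → 1 ≤ p → p ≤ n → π p ≡ m → c m ≡ r → 1 ≤ r →
                  Parks n c (restrict π m) m ⇔ (r ≤ p × (∀ j → r ≤ j → j < p → π j < m))
last-car-parks⇔ n m π c p r (range , injective , _) 1≤p p≤n πp≡m cm≡r 1≤r = mk⇔ to from
  where
  1≤π : ∀ j → 1 ≤ j → j ≤ n → 1 ≤ π j
  1≤π j 1≤j j≤n = proj₁ (range j 1≤j j≤n)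
  inC : ∀ j → r ≤ j → j ≤ n → InC n c m j
  inC j r≤j j≤n = subst (_≤ j) (sym cm≡r) r≤j , j≤n
  to : Parks n c (restrict π m) m → r ≤ p × (∀ j → r ≤ j → j < p → π j < m)
  to (j , 1≤j , j≤n , ej , (cj , _) , _ , least) = r≤p , occupied
    where
    j≡p : j ≡ p
    j≡p = injective j p 1≤j j≤n 1≤p p≤n (trans (proj₁ (restrict-just π m j m ej)) (sym πp≡m))
    r≤p : r ≤ p
    r≤p = subst (r ≤_) j≡p (subst (_≤ j) cm≡r cj)
    occupied : ∀ j' → r ≤ j' → j' < p → π j' < m
    occupied j' r≤j' j'<p with π j' <? m
    ... | yes πj'<m = πj'<m
    ... | no πj'≮m = ⊥-elim (<⇒≱ j'<p (subst (_≤ j') j≡p (least j' (inC j' r≤j' j'≤n) free)))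
      where
      j'≤n : j' ≤ n
      j'≤n = ≤-trans (<⇒≤ j'<p) p≤n
      free : ¬ Taken (restrict π m) m j'
      free taken = πj'≮m (Equivalence.to (taken-last⇔ π m j' (1≤π j' (≤-trans 1≤r r≤j') j'≤n)) taken)
  from : r ≤ p × (∀ j → r ≤ j → j < p → π j < m) → Parks n c (restrict π m) m
  from (r≤p , occupied) =
    p , 1≤p , p≤n , just-restrict π m p m πp≡m ≤-refl , inC p r≤p p≤n , free-p , least
    where
    free-p : ¬ Taken (restrict π m) m p
    free-p taken = <-irrefl πp≡m (Equivalence.to (taken-last⇔ π m p (1≤π p 1≤p p≤n)) taken)
    least : ∀ j' → InC n c m j' → ¬ Taken (restrict π m) m j' → p ≤ j'
    least j' (cj' , j'≤n) free with p ≤? j'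
    ... | yes p≤j' = p≤j'
    ... | no p≰j' = ⊥-elim (free (Equivalence.from (taken-last⇔ π m j' (1≤π j' (≤-trans 1≤r r≤j') j'≤n))
                                                   (occupied j' r≤j' (≰⇒> p≰j'))))
      where
      r≤j' : r ≤ j'
      r≤j' = subst (_≤ j') cm≡r cj'

-- Since π is injective and π p = m, a position left of p carries a letter
-- smaller than m iff it carries a letter at most m.
occupied-before⇔ : ∀ n m π q r → IsPerm n π → suc q ≤ n → π (suc q) ≡ m → 1 ≤ r →
                   (∀ j → r ≤ j → j < suc q → π j < m) ⇔ (∀ j → r ≤ j → j ≤ q → π j ≤ m)
occupied-before⇔ n m π q r (_ , injective , _) p≤n πp≡m 1≤r = mk⇔ to from
  where
  to : (∀ j → r ≤ j → j < suc q → π j < m) → ∀ j → r ≤ j → j ≤ q → π j ≤ m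
  to smaller j r≤j j≤q = <⇒≤ (smaller j r≤j (s≤s j≤q))
  from : (∀ j → r ≤ j → j ≤ q → π j ≤ m) → ∀ j → r ≤ j → j < suc q → π j < m
  from atMost j r≤j (s≤s j≤q) = ≤∧≢⇒< (atMost j r≤j j≤q) πj≢m
    where
    πj≢m : ¬ π j ≡ m
    πj≢m πj≡m = <-irrefl j≡p (s≤s j≤q)
      where
      j≡p : j ≡ suc q
      j≡p = injective j (suc q) (≤-trans 1≤r r≤j) (≤-trans (m≤n⇒m≤1+n j≤q) p≤n) (s≤s z≤n) p≤n
                      (trans πj≡m (sym πp≡m))

-- The scan goLeft π v k counts the letters ≤ v met leftwards from k, so
-- all positions of [r, k] carry letters ≤ v iff r lies right of k - goLeft.
goLeft-window : ∀ π v k r → 1 ≤ r →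
                (∀ j → r ≤ j → j ≤ k → π j ≤ v) ⇔ (k ∸ goLeft π v k < r)
goLeft-window π v zero r 1≤r = mk⇔ (λ _ → 1≤r) (λ _ j r≤j j≤0 → ⊥-elim (<⇒≱ (≤-trans 1≤r r≤j) j≤0))
goLeft-window π v (suc k) r 1≤r with π (suc k) ≤? v
... | yes πk+1≤v = mk⇔ (λ bounded → to (λ j r≤j j≤k → bounded j r≤j (m≤n⇒m≤1+n j≤k)))
                       (λ k-g<r j r≤j j≤k+1 → extend-right (from k-g<r) j r≤j j≤k+1)
  where
  open Equivalence (goLeft-window π v k r 1≤r)
  extend-right : (∀ j → r ≤ j → j ≤ k → π j ≤ v) → ∀ j → r ≤ j → j ≤ suc k → π j ≤ v
  extend-right bounded j r≤j j≤k+1 with m≤n⇒m<n∨m≡n j≤k+1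
  ... | inj₁ (s≤s j≤k) = bounded j r≤j j≤k
  ... | inj₂ refl = πk+1≤v
... | no πk+1≰v = mk⇔ to (λ k+1<r j r≤j j≤k+1 → ⊥-elim (<⇒≱ k+1<r (≤-trans r≤j j≤k+1)))
  where
  to : (∀ j → r ≤ j → j ≤ suc k → π j ≤ v) → suc k < r
  to bounded with suc k <? r
  ... | yes k+1<r = k+1<r
  ... | no k+1≮r = ⊥-elim (πk+1≰v (bounded (suc k) (≮⇒≥ k+1≮r) ≤-refl))

lemma3p6 : (n m : ℕ) (π : ℕ → ℕ) → IsPerm n π → 1 ≤ m → m ≤ n →
           (c : ℕ → ℕ) → IsPPF n (m ∸ 1) c (restrict π (m ∸ 1)) →
           (p : ℕ) → 1 ≤ p → p ≤ n → π p ≡ m →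
           (r : ℕ) → 1 ≤ r → r ≤ n →
           IsPPF n m (extend c m r) (restrict π m) ⇔ (p ∸ a π p + 1 ≤ r × r ≤ p)
-- With m = π_p: the first m-1 cars are unaffected, so everything reduces to
-- car m parking at p, which is the window condition on r.
lemma3p6 n .(π (suc q)) π perm 1≤m _ c ppf (suc q) 1≤p p≤n refl r 1≤r r≤n = mk⇔ to from
  where
  m : ℕ
  m = π (suc q)
  c' : ℕ → ℕ
  c' = extend c m r
  last-car : Parks n c' (restrict π m) m ⇔ (r ≤ suc q × (∀ j → r ≤ j → j < suc q → π j < m))
  last-car = last-car-parks⇔ n m π c' (suc q) r perm 1≤p p≤n refl (extend-eq c m r) 1≤r
  window : (∀ j → r ≤ j → j < suc q → π j < m) ⇔ (q ∸ goLeft π m q + 1 ≤ r)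
  window = ⇔-trans (occupied-before⇔ n m π q r perm p≤n refl 1≤r)
           (⇔-trans (goLeft-window π m q r 1≤r)
                    (mk⇔ (subst (_≤ r) (+-comm 1 _)) (subst (_≤ r) (+-comm _ 1))))
  to : IsPPF n m c' (restrict π m) → q ∸ goLeft π m q + 1 ≤ r × r ≤ suc q
  to ppf' with Equivalence.to last-car (ppf-last n m c' (restrict π m) 1≤m ppf')
  ... | r≤p , occupied = Equivalence.to window occupied , r≤p
  from : q ∸ goLeft π m q + 1 ≤ r × r ≤ suc q → IsPPF n m c' (restrict π m)
  from (r-large , r≤p) =
    ppf-snoc n m c' (restrict π m) (extend-ppf n m π c r 1≤m ppf)
             (subst (λ x → 1 ≤ x × x ≤ n) (sym (extend-eq c m r)) (1≤r , r≤n))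
             (Equivalence.from last-car (r≤p , Equivalence.from window r-large))
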